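{- Let $K_f$ be the countable rich structure for $C_\mu(\mathbb{C}_f)$ (an algebraically closed field $K$ with a bijection $f:K\to K$, $f(0)=0$, such that for all $a_1\ne a_2$ and $b$ the equation $f(a_1x)-f(a_2x)=b$ has a unique solution $x$). Define $T(a,x,b)=f^{ -1}(f(ax)+b)$. Then $(K,T)$ with the elements $0$ and $1$ of the field $K$ is a ternary ring.
   Context: $f$ originates from an entire Liouville function (Wilkie/Koiran) on $\mathbb{C}$, normalized to $f(0)=0$; $K_f$ is the rich (Fraïssé–Hrushovski limit) structure of the collapsed class $C_\mu(\mathbb{C}_f)$ of finite $L^{alg}$-substructures of $(\mathbb{C},+,\cdot,f)$ satisfying the predimension inequality $\mathrm{trd}(Y)-|Y^2\cap\mathrm{graph}(f)|\ge 0$ and having at most one solution of $f(a_1x)-f(a_2x)=b$ for given $a_1,a_2,b$. A ternary ring is a set $R$ with distinguished $0,1$ and $T:R^3\to R$ such that: (T1) $T(1,a,0)=T(a,1,0)=a$; (T2) $T(a,0,c)=T(0,a,c)=c$; (T3) for all $a,b,c$ the equation $T(a,b,y)=c$ has a unique solution $y$; (T4) if $a\ne a'$, the equation $T(x,a,b)=T(x,a',b')$ has a unique solution $x$; (T5) if $a\ne a'$, the system $T(a,x,y)=b$, $T(a',x,y)=b'$ has a unique solution $(x,y)$.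
   Formalization: The ternary operation is T(a,x,b) = f⁻¹(f(ax)+f(b)), with f applied to b, in place of f⁻¹(f(ax)+b). The statement above fails without it. -}

module Defs where

open import Level using (Level; _⊔_)
open import Algebra.Bundles using (CommutativeRing)
open import Data.Nat using (ℕ; _≥_)
open import Data.List using (List; []; _∷_; _++_; [_]; length)
open import Data.Product using (Σ; ∃; ∃!; _×_; _,_)
open import Relation.Nullary using (¬_)

module _ {c ℓ : Level} (R : CommutativeRing c ℓ) where
  open CommutativeRing R

  IsField : Set (c ⊔ ℓ)
  IsField = (¬ (0# ≈ 1#)) × (∀ x → ¬ (x ≈ 0#) → ∃ λ y → x * y ≈ 1#)

  evalPoly : List Carrier → Carrier → Carrier
  evalPoly []       x = 0#
  evalPoly (a ∷ as) x = a + x * evalPoly as x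

  IsAlgClosed : Set (c ⊔ ℓ)
  IsAlgClosed = (as : List Carrier) → length as ≥ 1 →
                ∃ λ x → evalPoly (as ++ [ 1# ]) x ≈ 0#

  IsCountable : Set (c ⊔ ℓ)
  IsCountable = ∃ λ (e : ℕ → Carrier) → ∀ x → ∃ λ n → e n ≈ x

  record IsPseudoExp (f finv : Carrier → Carrier) : Set (c ⊔ ℓ) where
    field
      f-cong      : ∀ {x y} → x ≈ y → f x ≈ f y
      finv-cong   : ∀ {x y} → x ≈ y → finv x ≈ finv y
      finv∘f      : ∀ x → finv (f x) ≈ x
      f∘finv      : ∀ y → f (finv y) ≈ y
      f0          : f 0# ≈ 0#
      uniqueSol   : ∀ a₁ a₂ b → ¬ (a₁ ≈ a₂) →
                    ∃! _≈_ (λ x → f (a₁ * x) - f (a₂ * x) ≈ b)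

  Tf : (f finv : Carrier → Carrier) → Carrier → Carrier → Carrier → Carrier
  Tf f finv a x b = finv (f (a * x) + f b)

record IsTernaryRing {c ℓ : Level} {A : Set c} (_≈_ : A → A → Set ℓ)
                     (0r 1r : A) (T : A → A → A → A) : Set (c ⊔ ℓ) where
  field
    T1 : ∀ a → (T 1r a 0r ≈ a) × (T a 1r 0r ≈ a)
    T2 : ∀ a c → (T a 0r c ≈ c) × (T 0r a c ≈ c)
    T3 : ∀ a b c → ∃! _≈_ (λ y → T a b y ≈ c)
    T4 : ∀ a a' b b' → ¬ (a ≈ a') → ∃! _≈_ (λ x → T x a b ≈ T x a' b')
    T5 : ∀ a a' b b' → ¬ (a ≈ a') →
         ∃! (λ p q → (Σ.proj₁ p ≈ Σ.proj₁ q) × (Σ.proj₂ p ≈ Σ.proj₂ q))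
            (λ (p : Σ A (λ _ → A)) → (T a (Σ.proj₁ p) (Σ.proj₂ p) ≈ b) ×
                                     (T a' (Σ.proj₁ p) (Σ.proj₂ p) ≈ b'))

-- Everything is read off through f: since f is a bijection, T(a,x,b) = c says exactly
-- f(ax) + f(b) = f(c). Thus (T1) and (T2) follow from f(0) = 0, (T3) is solving a
-- linear equation in f(y), and subtracting the two defining equations of (T4) or (T5)
-- leaves f(ax) − f(a'x) = const, whose unique solvability is the pseudo-exponential axiom.
module Submission where

open import Defs
open import Level using (Level)
open import Algebra.Bundles using (AbelianGroup; CommutativeRing)
open import Data.Product using (Σ; ∃!; _×_; _,_; proj₁; proj₂)
open import Function.Bundles using (_⇔_; mk⇔; Equivalence)
import Function.Properties.Equivalence as ⇔
open import Relation.Binary.Core using (Rel)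
open import Relation.Nullary using (¬_)
import Algebra.Properties.AbelianGroup as AbelianGroupProperties
import Algebra.Properties.CommutativeSemigroup as CommutativeSemigroupProperties
import Relation.Binary.Reasoning.Setoid as SetoidReasoning

open Equivalence using (to; from)

∃!-resp-⇔ : ∀ {a p q ℓ} {A : Set a} {_≈_ : Rel A ℓ} {P : A → Set p} {Q : A → Set q} →
            (∀ x → P x ⇔ Q x) → ∃! _≈_ P → ∃! _≈_ Q
∃!-resp-⇔ P⇔Q (x , Px , unique) = x , to (P⇔Q x) Px , λ {y} Qy → unique (from (P⇔Q y) Qy)

module AbelianGroupEquations {a ℓ} (G : AbelianGroup a ℓ) where
  open AbelianGroup G
  open AbelianGroupProperties G
  open CommutativeSemigroupProperties commutativeSemigroup using (interchange; x∙yz≈y∙xz)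
  open SetoidReasoning setoid

  x∙y≈z⇔y≈z-x : ∀ {x y z} → x ∙ y ≈ z ⇔ y ≈ z - x
  x∙y≈z⇔y≈z-x {x} {y} {z} = mk⇔
    (λ x∙y≈z → x≈z//y y x z (trans (comm y x) x∙y≈z))
    (λ y≈z-x → begin
      x ∙ y        ≈⟨ comm x y ⟩
      y ∙ x        ≈⟨ ∙-congʳ y≈z-x ⟩
      (z - x) ∙ x  ≈⟨ //-rightDividesˡ x z ⟩
      z            ∎)

  xz-yz≈x-y : ∀ x y z → (x ∙ z) - (y ∙ z) ≈ x - y
  xz-yz≈x-y x y z = begin
    (x ∙ z) ∙ (y ∙ z) ⁻¹     ≈⟨ ∙-congˡ (⁻¹-∙-comm y z) ⟨
    (x ∙ z) ∙ (y ⁻¹ ∙ z ⁻¹)  ≈⟨ interchange x z (y ⁻¹) (z ⁻¹) ⟩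
    (x - y) ∙ (z ∙ z ⁻¹)     ≈⟨ ∙-congˡ (inverseʳ z) ⟩
    (x - y) ∙ ε              ≈⟨ identityʳ (x - y) ⟩
    x - y                    ∎

  x∙u≈y∙v⇔x-y≈v-u : ∀ {x y u v} → x ∙ u ≈ y ∙ v ⇔ x - y ≈ v - u
  x∙u≈y∙v⇔x-y≈v-u {x} {y} {u} {v} = mk⇔
    (λ e → begin
      x - y              ≈⟨ xz-yz≈x-y x y u ⟨
      (x ∙ u) - (y ∙ u)  ≈⟨ ∙-congʳ e ⟩
      (y ∙ v) - (y ∙ u)  ≈⟨ yv-yu≈v-u ⟩
      v - u              ∎)
    (λ e → ∙-cancelʳ ((y ∙ u) ⁻¹) (x ∙ u) (y ∙ v) (begin
      (x ∙ u) - (y ∙ u)  ≈⟨ xz-yz≈x-y x y u ⟩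
      x - y              ≈⟨ e ⟩
      v - u              ≈⟨ yv-yu≈v-u ⟨
      (y ∙ v) - (y ∙ u)  ∎))
    where
    yv-yu≈v-u : (y ∙ v) - (y ∙ u) ≈ v - u
    yv-yu≈v-u = trans (//-cong₂ (comm y v) (comm y u)) (xz-yz≈x-y v u y)

  x∙z≈u⇒[y∙z≈v⇔x-y≈u-v] : ∀ {x y z u v} → x ∙ z ≈ u → y ∙ z ≈ v ⇔ x - y ≈ u - v
  x∙z≈u⇒[y∙z≈v⇔x-y≈u-v] {x} {y} {z} {u} {v} x∙z≈u =
    ⇔.trans (mk⇔ y∙z≈v⇒x∙v≈y∙u x∙v≈y∙u⇒y∙z≈v) x∙u≈y∙v⇔x-y≈v-u
    where
    x∙yz≈y∙u : x ∙ (y ∙ z) ≈ y ∙ u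
    x∙yz≈y∙u = trans (x∙yz≈y∙xz x y z) (∙-congˡ x∙z≈u)

    y∙z≈v⇒x∙v≈y∙u : y ∙ z ≈ v → x ∙ v ≈ y ∙ u
    y∙z≈v⇒x∙v≈y∙u y∙z≈v = trans (∙-congˡ (sym y∙z≈v)) x∙yz≈y∙u

    x∙v≈y∙u⇒y∙z≈v : x ∙ v ≈ y ∙ u → y ∙ z ≈ v
    x∙v≈y∙u⇒y∙z≈v e = ∙-cancelˡ x (y ∙ z) v (trans x∙yz≈y∙u (sym e))

module PseudoExponential {c ℓ} (K : CommutativeRing c ℓ)
  (f finv : CommutativeRing.Carrier K → CommutativeRing.Carrier K)
  (isPseudoExp : IsPseudoExp K f finv) where
  open CommutativeRing K
  open IsPseudoExp isPseudoExp
  open AbelianGroupEquations +-abelianGroup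

  T : Carrier → Carrier → Carrier → Carrier
  T = Tf K f finv

  finv≈⇔≈f : ∀ {u y} → finv u ≈ y ⇔ u ≈ f y
  finv≈⇔≈f {u} {y} = mk⇔
    (λ e → trans (sym (f∘finv u)) (f-cong e))
    (λ e → trans (finv-cong e) (finv∘f y))

  ≈finv⇔f≈ : ∀ {y u} → y ≈ finv u ⇔ f y ≈ u
  ≈finv⇔f≈ {y} {u} = mk⇔
    (λ e → trans (f-cong e) (f∘finv u))
    (λ e → trans (sym (finv∘f y)) (finv-cong e))

  T≈⇔ : ∀ {a x b c} → T a x b ≈ c ⇔ f (a * x) + f b ≈ f c
  T≈⇔ = finv≈⇔≈f

  T≈T⇔ : ∀ {a x b a' x' b'} → T a x b ≈ T a' x' b' ⇔ f (a * x) + f b ≈ f (a' * x') + f b'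
  T≈T⇔ {a' = a'} {x'} {b'} = ⇔.trans T≈⇔ (mk⇔
    (λ e → trans e (f∘finv (f (a' * x') + f b')))
    (λ e → trans e (sym (f∘finv (f (a' * x') + f b')))))

  T-identityʳ : ∀ a x → T a x 0# ≈ a * x
  T-identityʳ a x = from T≈⇔ (trans (+-congˡ f0) (+-identityʳ (f (a * x))))

  a*x≈0⇒T[a,x,c]≈c : ∀ {a x} c → a * x ≈ 0# → T a x c ≈ c
  a*x≈0⇒T[a,x,c]≈c c ax≈0 = from T≈⇔ (trans (+-congʳ (trans (f-cong ax≈0) f0)) (+-identityˡ (f c)))

  T-inv : Carrier → Carrier → Carrier → Carrier
  T-inv a x c = finv (f c - f (a * x))

  T-inv-cong : ∀ {a a' x x' c c'} → a ≈ a' → x ≈ x' → c ≈ c' → T-inv a x c ≈ T-inv a' x' c'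
  T-inv-cong a≈a' x≈x' c≈c' = finv-cong (+-cong (f-cong c≈c') (-‿cong (f-cong (*-cong a≈a' x≈x'))))

  T≈⇔≈T-inv : ∀ {a x y c} → T a x y ≈ c ⇔ y ≈ T-inv a x c
  T≈⇔≈T-inv = ⇔.trans T≈⇔ (⇔.trans x∙y≈z⇔y≈z-x (⇔.sym ≈finv⇔f≈))

  T[x,a,b]≈T[x,a',b']⇔ : ∀ {a a' b b' x} →
                         T x a b ≈ T x a' b' ⇔ f (a * x) - f (a' * x) ≈ f b' - f b
  T[x,a,b]≈T[x,a',b']⇔ {a} {a'} {x = x} = ⇔.trans T≈T⇔ (⇔.trans x∙u≈y∙v⇔x-y≈v-u (mk⇔
    (λ e → trans (sym commute) e)
    (λ e → trans commute e)))
    where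
    commute : f (x * a) - f (x * a') ≈ f (a * x) - f (a' * x)
    commute = +-cong (f-cong (*-comm x a)) (-‿cong (f-cong (*-comm x a')))

  T[a,x,y]≈b⇒[T[a',x,y]≈b'⇔] : ∀ {a a' b b' x y} → T a x y ≈ b →
                               T a' x y ≈ b' ⇔ f (a * x) - f (a' * x) ≈ f b - f b'
  T[a,x,y]≈b⇒[T[a',x,y]≈b'⇔] e = ⇔.trans T≈⇔ (x∙z≈u⇒[y∙z≈v⇔x-y≈u-v] (to T≈⇔ e))

  T-unique-solutionʳ : ∀ a b c → ∃! _≈_ (λ y → T a b y ≈ c)
  T-unique-solutionʳ a b c = T-inv a b c , from T≈⇔≈T-inv refl , λ e → sym (to T≈⇔≈T-inv e)

  T-unique-intersection : ∀ a a' b b' → ¬ (a ≈ a') → ∃! _≈_ (λ x → T x a b ≈ T x a' b')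
  T-unique-intersection a a' b b' a≉a' =
    ∃!-resp-⇔ (λ _ → ⇔.sym T[x,a,b]≈T[x,a',b']⇔) (uniqueSol a a' (f b' - f b) a≉a')

  T-unique-line : ∀ a a' b b' → ¬ (a ≈ a') →
    ∃! (λ p q → (proj₁ p ≈ proj₁ q) × (proj₂ p ≈ proj₂ q))
       (λ (p : Σ Carrier (λ _ → Carrier)) → (T a (proj₁ p) (proj₂ p) ≈ b) ×
                                            (T a' (proj₁ p) (proj₂ p) ≈ b'))
  T-unique-line a a' b b' a≉a' with uniqueSol a a' (f b - f b') a≉a'
  ... | x , fax-fa'x≈fb-fb' , x-unique = (x , y) , (Taxy≈b , Ta'xy≈b') , unique
    where
    y : Carrier
    y = T-inv a x b

    Taxy≈b : T a x y ≈ b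
    Taxy≈b = from T≈⇔≈T-inv refl

    Ta'xy≈b' : T a' x y ≈ b'
    Ta'xy≈b' = from (T[a,x,y]≈b⇒[T[a',x,y]≈b'⇔] Taxy≈b) fax-fa'x≈fb-fb'

    unique : ∀ {q} → (T a (proj₁ q) (proj₂ q) ≈ b) × (T a' (proj₁ q) (proj₂ q) ≈ b') →
             (x ≈ proj₁ q) × (y ≈ proj₂ q)
    unique {x' , y'} (Tax'y'≈b , Ta'x'y'≈b') = x≈x' , y≈y'
      where
      x≈x' : x ≈ x'
      x≈x' = x-unique (to (T[a,x,y]≈b⇒[T[a',x,y]≈b'⇔] Tax'y'≈b) Ta'x'y'≈b')

      y≈y' : y ≈ y'
      y≈y' = trans (T-inv-cong refl x≈x' refl) (sym (to T≈⇔≈T-inv Tax'y'≈b))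

  isTernaryRing : IsTernaryRing _≈_ 0# 1# T
  isTernaryRing = record
    { T1 = λ a → trans (T-identityʳ 1# a) (*-identityˡ a) , trans (T-identityʳ a 1#) (*-identityʳ a)
    ; T2 = λ a c → a*x≈0⇒T[a,x,c]≈c c (zeroʳ a) , a*x≈0⇒T[a,x,c]≈c c (zeroˡ a)
    ; T3 = T-unique-solutionʳ
    ; T4 = T-unique-intersection
    ; T5 = T-unique-line
    }

lemma4p2 : {c ℓ : Level} (K : CommutativeRing c ℓ) →
    IsField K → IsAlgClosed K → IsCountable K →
    (f finv : CommutativeRing.Carrier K → CommutativeRing.Carrier K) →
    IsPseudoExp K f finv →
    IsTernaryRing (CommutativeRing._≈_ K) (CommutativeRing.0# K) (CommutativeRing.1# K) (Tf K f finv)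
lemma4p2 K _ _ _ f finv isPseudoExp = PseudoExponential.isTernaryRing K f finv isPseudoExp
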